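{- Let $P$ be a finite graded poset with minimum $\hat0$ in which every maximal chain has length $n$, let $\lambda$ be a generalized CW-labeling of $P$, and let $U_1,\dots,U_{n-1}:\mathcal M_P\to\mathcal M_P$ be the maps defined below on the set $\mathcal M_P$ of maximal chains of $P$. Then: (1) for every $\mathbf c\in\mathcal M_P$, $U_i(\mathbf c)$ and $\mathbf c$ agree except possibly at rank $i$; (2) $U_i^2=U_i$ for all $i$; (3) $U_iU_j=U_jU_i$ whenever $|i-j|>1$; (4) $U_iU_{i+1}U_i=U_{i+1}U_iU_{i+1}$ for all $i$.
   Context: C-labelings. A C-labeling gives each pair (maximal chain $\mathbf m$, cover $e$ in $\mathbf m$) a label $\lambda(\mathbf m,e)$ in a poset $\Lambda$, so that maximal chains agreeing along their bottom $d$ edges have equal labels there. Saturated chains from $\hat0$ thus have well-defined labels. A chain $x_0\lessdot\cdots\lessdot x_\ell$ has an ascent at rank $i$ if $\lambda(\mathbf c,x_{i-1}\lessdot x_i)<\lambda(\mathbf c,x_i\lessdot x_{i+1})$. A rooted interval $[x,y]_{\mathbf r}$ is an interval with a saturated chain $\mathbf r$ from $\hat0$ to $x$. A CR-labeling is one where each rooted interval has exactly one maximal chain $\mathbf c$ such that $\mathbf r\cup\mathbf c$ ascends at every rank strictly between $\rho(x)$ and $\rho(y)$. Rank two switching property. For every maximal chain $\mathbf m:\hat0=m_0\lessdot\cdots\lessdot m_k$ with an ascent at rank $i$, there is a unique $m_i'\ne m_i$ such that replacing $m_i$ by $m_i'$ yields a maximal chain with the same labels except swapped at ranks $i,i+1$;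 $m_i'$ depends only on $m_0,\dots,m_{i+1}$. For a saturated chain $\mathbf c$ from $\hat0$, $U_i(\mathbf c)$ is the chain obtained by this replacement (a quadratic exchange) if $\mathbf c$ has an ascent at rank $i$, and $U_i(\mathbf c)=\mathbf c$ otherwise. Restricted to maximal chains, these are the maps $U_i:\mathcal M_P\to\mathcal M_P$. Braid relation: $U_iU_{i+1}U_i(\mathbf c)=U_{i+1}U_iU_{i+1}(\mathbf c)$ whenever $\mathbf c$ (a saturated chain from $\hat0$) ascends at $i$ and $i+1$. $\mathbf c_1\sim_{\lambda_{\mathbf r}}\mathbf c_2$ for maximal chains of a rooted interval $[x,y]_{\mathbf r}$ means $\mathbf r\cup\mathbf c_1$ and $\mathbf r\cup\mathbf c_2$ are related by quadratic exchanges and their inverses at ranks strictly between $\rho(x)$ and $\rho(y)$. Cancellative property: for $z<x<y$, $\mathbf r\in\mathcal M_{[\hat0,z]}$, $\mathbf c\in\mathcal M_{[z,x]}$ and $\mathbf c_1,\mathbf c_2\in\mathcal M_{[x,y]}$, $\mathbf c\cup\mathbf c_1\sim_{\lambda_{\mathbf r}}\mathbf c\cup\mathbf c_2$ implies $\mathbf c_1\sim_{\lambda_{\mathbf r\cup\mathbf c}}\mathbf c_2$. A generalized CW-labeling is a CR-labeling with the rank two switching property, the braid relation and the cancellative property. -}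

module Defs where

open import Level using (0ℓ)
open import Data.Nat using (ℕ; zero; suc; _+_; _≤_; _<_; pred)
open import Data.Nat.Properties using (_≟_)
open import Data.Fin using (Fin)
open import Data.Product using (Σ; Σ-syntax; _×_; _,_; proj₁; proj₂)
open import Data.Sum using (_⊎_)
open import Relation.Nullary using (¬_; yes; no)
open import Relation.Binary using (Rel; IsPartialOrder)
open import Relation.Binary.PropositionalEquality using (_≡_; _≢_)
open import Function.Bundles using (_↔_)

record FinPoset : Set₁ where
  field
    Carrier        : Set
    _≼_            : Rel Carrier 0ℓ
    isPartialOrder : IsPartialOrder _≡_ _≼_
    size           : ℕ
    enumerate      : Carrier ↔ Fin size

  _≺_ : Rel Carrier 0ℓ
  x ≺ y = x ≼ y × x ≢ y

  _⋖_ : Rel Carrier 0ℓ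
  x ⋖ y = x ≺ y × (∀ z → x ≺ z → ¬ (z ≺ y))

  IsMinimum : Carrier → Set
  IsMinimum z = ∀ x → z ≼ x

  IsMaximal : Carrier → Set
  IsMaximal x = ∀ y → ¬ (x ≺ y)

record LabelPoset : Set₁ where
  field
    Label          : Set
    _≤L_           : Rel Label 0ℓ
    isPartialOrder : IsPartialOrder _≡_ _≤L_

  _<L_ : Rel Label 0ℓ
  x <L y = x ≤L y × x ≢ y

-- Chains.  A chain x₀ , x₁ , … , x_k is represented by a sequence
-- ℕ → Carrier together with its length k; only the entries 0 … k
-- are ever inspected.

module Chains (P : FinPoset) (bot : FinPoset.Carrier P) where
  open FinPoset P

  Seq : Set
  Seq = ℕ → Carrier

  _≈[_]_ : Seq → ℕ → Seq → Set
  c ≈[ k ] d = ∀ j → j ≤ k → c j ≡ d j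

  SatFrom0 : ℕ → Seq → Set
  SatFrom0 k c = c 0 ≡ bot × (∀ j → j < k → c j ⋖ c (suc j))

  IsMaxChain : ℕ → Seq → Set
  IsMaxChain k c = SatFrom0 k c × IsMaximal (c k)

  AllMaxChainsHaveLength : ℕ → Set
  AllMaxChainsHaveLength n = ∀ k c → IsMaxChain k c → k ≡ n

  MaxChain : ℕ → Set
  MaxChain n = Σ Seq (IsMaxChain n)

  replace : Seq → ℕ → Carrier → Seq
  replace c i x j with j ≟ i
  ... | yes _ = x
  ... | no  _ = c j

-- Labelings.  lab m j is the label λ(m, m_j ⋖ m_{j+1}) of the
-- (j+1)-st cover of the maximal chain m (for j < n).

module Labelled (P : FinPoset) (bot : FinPoset.Carrier P) (n : ℕ)
                (Λ : LabelPoset)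
                (lab : Chains.MaxChain P bot n → ℕ → LabelPoset.Label Λ) where
  open FinPoset P
  open Chains P bot
  open LabelPoset Λ

  M : Set
  M = MaxChain n

  IsCLabeling : Set
  IsCLabeling = ∀ (m m' : M) d → d ≤ n → proj₁ m ≈[ d ] proj₁ m' →
                ∀ j → j < d → lab m j ≡ lab m' j

  Extends : ℕ → Seq → M → Set
  Extends k c m = c ≈[ k ] proj₁ m

  -- the saturated chain c (of length k, from bot) has an ascent at
  -- rank i; its labels are those of any maximal chain extending it
  Ascent : ℕ → Seq → ℕ → Set
  Ascent k c i = 1 ≤ i × i < k ×
    Σ[ m ∈ M ] (Extends k c m × lab m (pred i) <L lab m i)

  -- A rooted interval [x,y]_r is given by a saturated
  -- chain r of length a from bot (x = r a) and y with x ≼ y.  A maximal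
  -- chain c of [x,y] (of length b) is encoded by the concatenation
  -- r ∪ c, a saturated chain s of length a + b from bot extending r
  -- with s (a + b) = y.

  RootedCompletion : ℕ → Seq → Carrier → ℕ → Seq → Set
  RootedCompletion a r y b s = SatFrom0 (a + b) s × r ≈[ a ] s × s (a + b) ≡ y

  AscendsBetween : ℕ → ℕ → Seq → Set
  AscendsBetween lo k s = ∀ i → lo < i → i < k → Ascent k s i

  IsCRLabeling : Set
  IsCRLabeling = ∀ a r y → SatFrom0 a r → r a ≼ y →
    Σ[ b ∈ ℕ ] Σ[ s ∈ Seq ]
      ( RootedCompletion a r y b s × AscendsBetween a (a + b) s ×
        (∀ b' s' → RootedCompletion a r y b' s' → AscendsBetween a (a + b') s' →
           b' ≡ b × s' ≈[ a + b ] s))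

  SwitchesTo : M → ℕ → Carrier → Set
  SwitchesTo m i x =
    x ≢ proj₁ m i ×
    Σ[ p ∈ IsMaxChain n (replace (proj₁ m) i x) ]
      ( lab (replace (proj₁ m) i x , p) (pred i) ≡ lab m i
      × lab (replace (proj₁ m) i x , p) i ≡ lab m (pred i)
      × (∀ j → j < n → j ≢ pred i → j ≢ i →
           lab (replace (proj₁ m) i x , p) j ≡ lab m j))

  record RankTwoSwitching : Set where
    field
      switch        : (m : M) (i : ℕ) → Ascent n (proj₁ m) i → Carrier
      switch-spec   : ∀ m i a → SwitchesTo m i (switch m i a)
      switch-unique : ∀ m i a x → SwitchesTo m i x → x ≡ switch m i a
      switch-local  : ∀ m m' i a a' → proj₁ m ≈[ suc i ] proj₁ m' →
                      switch m i a ≡ switch m' i a'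

  module WithSwitching (S : RankTwoSwitching) where
    open RankTwoSwitching S

    QExch : ℕ → Seq → ℕ → Seq → Set
    QExch k c i d = i < k ×
      Σ[ m ∈ M ] Σ[ e ∈ Extends k c m ] Σ[ a ∈ Ascent n (proj₁ m) i ]
        (d ≈[ k ] replace c i (switch m i a))

    UStep : ℕ → Seq → ℕ → Seq → Set
    UStep k c i d = QExch k c i d ⊎ (¬ Ascent k c i × c ≈[ k ] d)

    BraidRelation : Set
    BraidRelation = ∀ k c i → SatFrom0 k c → Ascent k c i → Ascent k c (suc i) →
      ∀ d₁ d₂ d₃ e₁ e₂ e₃ →
      UStep k c i d₁ → UStep k d₁ (suc i) d₂ → UStep k d₂ i d₃ →
      UStep k c (suc i) e₁ → UStep k e₁ i e₂ → UStep k e₂ (suc i) e₃ →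
      d₃ ≈[ k ] e₃

    data Connected (lo k : ℕ) : Seq → Seq → Set where
      same   : ∀ {c d} → c ≈[ k ] d → Connected lo k c d
      exch   : ∀ {c d i} → lo < i → i < k → QExch k c i d → Connected lo k c d
      exch⁻¹ : ∀ {c d i} → lo < i → i < k → QExch k d i c → Connected lo k c d
      trans  : ∀ {c d e} → Connected lo k c d → Connected lo k d e → Connected lo k c e

    -- z = s (a), x = s (a + b), y = s (a + b + e); r = s|[0,a],
    -- c = s|[a,a+b], c₁ , c₂ the tails of s₁ , s₂
    Cancellative : Set
    Cancellative = ∀ a b e s₁ s₂ → 0 < b → 0 < e →
      SatFrom0 (a + b + e) s₁ → SatFrom0 (a + b + e) s₂ →
      s₁ ≈[ a + b ] s₂ → s₁ (a + b + e) ≡ s₂ (a + b + e) →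
      Connected a (a + b + e) s₁ s₂ → Connected (a + b) (a + b + e) s₁ s₂

  record IsGeneralizedCW : Set where
    field
      isC          : IsCLabeling
      isCR         : IsCRLabeling
      rankTwo      : RankTwoSwitching
      braid        : WithSwitching.BraidRelation rankTwo
      cancellative : WithSwitching.Cancellative rankTwo

  AreUMaps : IsGeneralizedCW → (ℕ → M → M) → Set
  AreUMaps G U = ∀ i → 1 ≤ i → i < n → ∀ c →
    WithSwitching.UStep (IsGeneralizedCW.rankTwo G) n (proj₁ c) i (proj₁ (U i c))

module Submission where

-- Everything is read off from the edge labels.  For a maximal chain c,
-- U_i either fixes c (no ascent at rank i) or replaces c_i by the
-- switching element, which swaps the labels of edges i-1 and i and keeps
-- all other labels.  Conversely, by uniqueness of the switching element,
-- a chain that changes c_i only and swaps exactly these two labels IS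
-- U_i c (recognition).  Hence:
--   (1) is the shape of U_i;  (2) U_i c has a descent at rank i, so U_i
--   fixes it;  (3) far-apart U_i, U_j never touch the labels the other
--   reads, so ascents persist and, when both act, U_i (U_j c) is
--   recognised as U_j (U_i c);  (4) if c ascends at i and i+1 this is the
--   braid relation, otherwise one side collapses and a label computation
--   shows that the remaining outer map acts trivially.

open import Defs
open import Data.Nat using (ℕ; suc; pred; _≤_; _<_; z≤n; s≤s)
open import Data.Nat.Properties
  using (_≟_; ≤-refl; ≤-trans; <⇒≤; <⇒≢; >⇒≢; n<1+n; n≤1+n; m<n⇒m<1+n; pred[n]≤n;
         ≤-<-trans; <-≤-trans)
open import Data.Product using (_,_; proj₁; proj₂; _×_)
open import Data.Sum using (_⊎_; inj₁; inj₂)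
open import Data.Empty using (⊥; ⊥-elim)
open import Relation.Nullary using (¬_; Dec; yes; no)
open import Level using (0ℓ)
open import Relation.Binary using (IsPartialOrder; Setoid)
import Relation.Binary.Reasoning.Setoid as SetoidReasoning
open import Relation.Binary.PropositionalEquality using (_≡_; _≢_; refl; sym; trans; cong; subst; subst₂)

-- Edge k joins ranks k and k+1.  An exchange at rank i changes the
-- labels of edges pred i and i only; the other edges are untouched.
Untouched : ℕ → ℕ → Set
Untouched i k = k ≢ pred i × k ≢ i

pred-< : ∀ {i n} → i < n → pred i < n
pred-< i<n = ≤-<-trans pred[n]≤n i<n

adjacent-untouched : ∀ {i} → 1 ≤ i → Untouched (suc i) (pred i) × Untouched i (suc i)
adjacent-untouched {suc i} _ =
  (<⇒≢ (n<1+n i) , <⇒≢ (m<n⇒m<1+n (n<1+n i))) ,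
  (>⇒≢ (m<n⇒m<1+n (n<1+n i)) , >⇒≢ (n<1+n (suc i)))

far-low : ∀ {i j} → suc j < i → ∀ {k} → k ≤ j → Untouched i k
far-low {suc i} {j} (s≤s j<i) {k} k≤j = <⇒≢ k<i , <⇒≢ (m<n⇒m<1+n k<i)
  where
    k<i : k < i
    k<i = ≤-<-trans k≤j j<i

far-high : ∀ {i j} → suc j < i → ∀ {k} → pred i ≤ k → Untouched j k
far-high {suc i} {j} (s≤s j<i) {k} i≤k = >⇒≢ (≤-<-trans pred[n]≤n j<k) , >⇒≢ j<k
  where
    j<k : j < k
    j<k = <-≤-trans j<i i≤k

far-prefix : ∀ {i j} → suc j < i → ∀ {k} → k ≤ suc j → k ≢ i
far-prefix sj<i k≤sj = <⇒≢ (≤-<-trans k≤sj sj<i)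

module ChainFacts (P : FinPoset) (bot : FinPoset.Carrier P) where
  open FinPoset P using (_⋖_; IsMaximal)
  open Chains P bot

  ≈-refl : ∀ {k} {s : Seq} → s ≈[ k ] s
  ≈-refl _ _ = refl

  ≈-sym : ∀ {k} {s t : Seq} → s ≈[ k ] t → t ≈[ k ] s
  ≈-sym s≈t j j≤k = sym (s≈t j j≤k)

  ≈-trans : ∀ {k} {s t u : Seq} → s ≈[ k ] t → t ≈[ k ] u → s ≈[ k ] u
  ≈-trans s≈t t≈u j j≤k = trans (s≈t j j≤k) (t≈u j j≤k)

  ≈-weaken : ∀ {k l} {s t : Seq} → l ≤ k → s ≈[ k ] t → s ≈[ l ] t
  ≈-weaken l≤k s≈t j j≤l = s≈t j (≤-trans j≤l l≤k)

  ≈-setoid : ℕ → Setoid 0ℓ 0ℓ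
  ≈-setoid k = record
    { Carrier = Seq ; _≈_ = _≈[ k ]_
    ; isEquivalence = record { refl = ≈-refl ; sym = ≈-sym ; trans = ≈-trans } }

  replace-at : ∀ (s : Seq) i x → replace s i x i ≡ x
  replace-at s i x with i ≟ i
  ... | yes _  = refl
  ... | no i≢i = ⊥-elim (i≢i refl)

  replace-off : ∀ (s : Seq) i x {j} → j ≢ i → replace s i x j ≡ s j
  replace-off s i x {j} j≢i with j ≟ i
  ... | yes j≡i = ⊥-elim (j≢i j≡i)
  ... | no _    = refl

  replace-cong : ∀ {k} {s t : Seq} i x → s ≈[ k ] t → replace s i x ≈[ k ] replace t i x
  replace-cong {s = s} {t} i x s≈t j j≤k = by-cases (j ≟ i)
    where
      by-cases : Dec (j ≡ i) → replace s i x j ≡ replace t i x j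
      by-cases (yes refl) = trans (replace-at s j x) (sym (replace-at t j x))
      by-cases (no j≢i)   =
        trans (replace-off s i x j≢i) (trans (s≈t j j≤k) (sym (replace-off t i x j≢i)))

  replace-comm : ∀ {k} (s : Seq) {i j} x y → i ≢ j →
                 replace (replace s i x) j y ≈[ k ] replace (replace s j y) i x
  replace-comm s {i} {j} x y i≢j m _ = by-cases (m ≟ i) (m ≟ j)
    where
      by-cases : Dec (m ≡ i) → Dec (m ≡ j) →
                 replace (replace s i x) j y m ≡ replace (replace s j y) i x m
      by-cases (yes refl) _ =
        trans (replace-off _ j y i≢j) (trans (replace-at s m x) (sym (replace-at _ m x)))
      by-cases (no m≢i) (yes refl) =
        trans (replace-at _ m y) (sym (trans (replace-off _ i x m≢i) (replace-at s m y)))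
      by-cases (no m≢i) (no m≢j) =
        trans (replace-off _ j y m≢j) (trans (replace-off s i x m≢i)
          (sym (trans (replace-off _ i x m≢i) (replace-off s j y m≢j))))

  isMaxChain-resp : ∀ {k} {s t : Seq} → s ≈[ k ] t → IsMaxChain k s → IsMaxChain k t
  isMaxChain-resp s≈t ((s₀≡bot , covers) , top) =
    (trans (sym (s≈t 0 z≤n)) s₀≡bot ,
     λ j j<k → subst₂ _⋖_ (s≈t j (<⇒≤ j<k)) (s≈t (suc j) j<k) (covers j j<k)) ,
    subst IsMaximal (s≈t _ ≤-refl) top

module Ascents (P : FinPoset) (bot : FinPoset.Carrier P) (n : ℕ) (Λ : LabelPoset)
  (lab : Chains.MaxChain P bot n → ℕ → LabelPoset.Label Λ)
  (isC : Labelled.IsCLabeling P bot n Λ lab) where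
  open Chains P bot
  open ChainFacts P bot
  open LabelPoset Λ using (_<L_; isPartialOrder)
  open Labelled P bot n Λ lab

  lab-resp : ∀ (c d : M) → proj₁ c ≈[ n ] proj₁ d → ∀ k → k < n → lab c k ≡ lab d k
  lab-resp c d c≈d = isC c d n ≤-refl c≈d

  <L-asym : ∀ {x y} → x <L y → ¬ (y <L x)
  <L-asym (x≤y , x≢y) (y≤x , _) = x≢y (IsPartialOrder.antisym isPartialOrder x≤y y≤x)

  <L-resp : ∀ {x y x' y'} → x ≡ x' → y ≡ y' → x <L y → x' <L y'
  <L-resp refl refl x<y = x<y

  ascent-resp : ∀ {k} {s t : Seq} {i} → s ≈[ k ] t → Ascent k s i → Ascent k t i
  ascent-resp s≈t (1≤i , i<k , m , s≈m , rise) = 1≤i , i<k , m , ≈-trans (≈-sym s≈t) s≈m , rise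

  ascent⇒rise : ∀ (c : M) {i} → Ascent n (proj₁ c) i → lab c (pred i) <L lab c i
  ascent⇒rise c (_ , i<n , m , c≈m , rise) =
    <L-resp (sym (lab-resp c m c≈m _ (pred-< i<n))) (sym (lab-resp c m c≈m _ i<n)) rise

  rise⇒ascent : ∀ (c : M) {i} → 1 ≤ i → i < n → lab c (pred i) <L lab c i → Ascent n (proj₁ c) i
  rise⇒ascent c 1≤i i<n rise = 1≤i , i<n , c , ≈-refl , rise

  ascent-transfer : ∀ (c d : M) {i} → lab c (pred i) ≡ lab d (pred i) → lab c i ≡ lab d i →
                    Ascent n (proj₁ c) i → Ascent n (proj₁ d) i
  ascent-transfer c d lower upper a@(1≤i , i<n , _) =
    rise⇒ascent d 1≤i i<n (<L-resp lower upper (ascent⇒rise c a))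

  record Swapped (d c : M) (i : ℕ) : Set where
    field
      lower : lab d (pred i) ≡ lab c i
      upper : lab d i ≡ lab c (pred i)
      rest  : ∀ k → k < n → Untouched i k → lab d k ≡ lab c k

  swapped-resp : ∀ {d d' c c' : M} {i} → i < n → proj₁ d ≈[ n ] proj₁ d' →
                 proj₁ c ≈[ n ] proj₁ c' → Swapped d c i → Swapped d' c' i
  swapped-resp {d} {d'} {c} {c'} i<n d≈d' c≈c' s = record
    { lower = trans (sym (Ld _ (pred-< i<n))) (trans (Swapped.lower s) (Lc _ i<n))
    ; upper = trans (sym (Ld _ i<n)) (trans (Swapped.upper s) (Lc _ (pred-< i<n)))
    ; rest  = λ k k<n u → trans (sym (Ld k k<n)) (trans (Swapped.rest s k k<n u) (Lc k k<n))
    }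
    where
      Ld : ∀ k → k < n → lab d k ≡ lab d' k
      Ld = lab-resp d d' d≈d'
      Lc : ∀ k → k < n → lab c k ≡ lab c' k
      Lc = lab-resp c c' c≈c'

  swapped-descent : ∀ {d c : M} {i} → Swapped d c i → Ascent n (proj₁ c) i → ¬ Ascent n (proj₁ d) i
  swapped-descent {d} {c} s a b =
    <L-asym (ascent⇒rise c a) (<L-resp (Swapped.lower s) (Swapped.upper s) (ascent⇒rise d b))

  swapped-far : ∀ {i j} {d c d' c' : M} → suc j < i → i < n → j < n →
                Swapped d c i → Swapped d' d j → Swapped c' c j → Swapped d' c' i
  swapped-far {i} {j} {d} {c} {d'} {c'} j≪i i<n j<n dc d'd c'c = record
    { lower = trans (rest d'd _ (pred-< i<n) (far-high j≪i ≤-refl))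
                (trans (lower dc) (sym (rest c'c _ i<n (far-high j≪i pred[n]≤n))))
    ; upper = trans (rest d'd _ i<n (far-high j≪i pred[n]≤n))
                (trans (upper dc) (sym (rest c'c _ (pred-< i<n) (far-high j≪i ≤-refl))))
    ; rest  = λ k k<n u → by-cases k k<n u (k ≟ pred j) (k ≟ j)
    }
    where
      open Swapped
      by-cases : ∀ k → k < n → Untouched i k → Dec (k ≡ pred j) → Dec (k ≡ j) → lab d' k ≡ lab c' k
      by-cases _ _ _ (yes refl) _ =
        trans (lower d'd) (trans (rest dc j j<n (far-low j≪i ≤-refl)) (sym (lower c'c)))
      by-cases _ _ _ (no _) (yes refl) =
        trans (upper d'd) (trans (rest dc _ (pred-< j<n) (far-low j≪i pred[n]≤n)) (sym (upper c'c)))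
      by-cases k k<n u (no k≢pj) (no k≢j) =
        trans (rest d'd k k<n (k≢pj , k≢j)) (trans (rest dc k k<n u) (sym (rest c'c k k<n (k≢pj , k≢j))))

module UMaps (P : FinPoset) (bot : FinPoset.Carrier P) (n : ℕ) (Λ : LabelPoset)
  (lab : Chains.MaxChain P bot n → ℕ → LabelPoset.Label Λ)
  (isC : Labelled.IsCLabeling P bot n Λ lab)
  (S : Labelled.RankTwoSwitching P bot n Λ lab)
  (U : ℕ → Chains.MaxChain P bot n → Chains.MaxChain P bot n)
  (isU : ∀ i → 1 ≤ i → i < n → ∀ c →
         Labelled.WithSwitching.UStep P bot n Λ lab S n (proj₁ c) i (proj₁ (U i c))) where
  open FinPoset P using (Carrier)
  open Chains P bot
  open ChainFacts P bot
  open Labelled P bot n Λ lab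
  open Ascents P bot n Λ lab isC
  open RankTwoSwitching S

  -- the defining property of U_i decides whether c ascends at rank i
  ascent? : ∀ {i} → 1 ≤ i → i < n → (c : M) → Ascent n (proj₁ c) i ⊎ ¬ Ascent n (proj₁ c) i
  ascent? {i} 1≤i i<n c with isU i 1≤i i<n c
  ... | inj₁ (_ , m , c≈m , a , _) = inj₁ (ascent-resp (≈-sym c≈m) a)
  ... | inj₂ (¬a , _)              = inj₂ ¬a

  U-fixes : ∀ {i} → 1 ≤ i → i < n → (c : M) → ¬ Ascent n (proj₁ c) i →
            proj₁ (U i c) ≈[ n ] proj₁ c
  U-fixes {i} 1≤i i<n c ¬a with isU i 1≤i i<n c
  ... | inj₁ (_ , m , c≈m , a , _) = ⊥-elim (¬a (ascent-resp (≈-sym c≈m) a))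
  ... | inj₂ (_ , c≈Uc)            = ≈-sym c≈Uc

  U-replaces : ∀ (c : M) {i} (a : Ascent n (proj₁ c) i) →
               proj₁ (U i c) ≈[ n ] replace (proj₁ c) i (switch c i a)
  U-replaces c {i} a@(1≤i , i<n , _) with isU i 1≤i i<n c
  ... | inj₂ (¬a , _) = ⊥-elim (¬a a)
  ... | inj₁ (_ , m , c≈m , a' , Uc≈) =
    subst (λ x → proj₁ (U i c) ≈[ n ] replace (proj₁ c) i x)
          (switch-local m c i a' a (≈-weaken i<n (≈-sym c≈m))) Uc≈

  switches⇒swapped : ∀ {c : M} {i x} (sw : SwitchesTo c i x) → Swapped (_ , proj₁ (proj₂ sw)) c i
  switches⇒swapped (_ , _ , lower , upper , rest) = record
    { lower = lower ; upper = upper ; rest = λ k k<n (k≢pi , k≢i) → rest k k<n k≢pi k≢i }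

  U-swaps : ∀ (c : M) {i} (a : Ascent n (proj₁ c) i) → Swapped (U i c) c i
  U-swaps c a@(_ , i<n , _) =
    swapped-resp i<n (≈-sym (U-replaces c a)) ≈-refl (switches⇒swapped (switch-spec c _ a))

  U-keeps : ∀ {i} → 1 ≤ i → i < n → (c : M) →
            ∀ k → k < n → Untouched i k → lab (U i c) k ≡ lab c k
  U-keeps {i} 1≤i i<n c k k<n u with ascent? 1≤i i<n c
  ... | inj₁ a  = Swapped.rest (U-swaps c a) k k<n u
  ... | inj₂ ¬a = lab-resp (U i c) c (U-fixes 1≤i i<n c ¬a) k k<n

  swapped⇒switches : ∀ {c : M} {i x} → x ≢ proj₁ c i → (max : IsMaxChain n (replace (proj₁ c) i x)) →
                     Swapped (_ , max) c i → SwitchesTo c i x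
  swapped⇒switches x≢ci max s =
    x≢ci , max , Swapped.lower s , Swapped.upper s ,
    λ k k<n k≢pi k≢i → Swapped.rest s k k<n (k≢pi , k≢i)

  U-recognise : ∀ (c : M) {i} (a : Ascent n (proj₁ c) i) (d : M) {x : Carrier} → x ≢ proj₁ c i →
                proj₁ d ≈[ n ] replace (proj₁ c) i x → Swapped d c i → proj₁ (U i c) ≈[ n ] proj₁ d
  U-recognise c {i} a@(_ , i<n , _) d {x} x≢ci d≈ swapped =
    ≈-trans (U-replaces c a) (subst (λ y → replace (proj₁ c) i y ≈[ n ] proj₁ d) x≡switch (≈-sym d≈))
    where
      max : IsMaxChain n (replace (proj₁ c) i x)
      max = isMaxChain-resp d≈ (proj₂ d)
      x≡switch : x ≡ switch c i a
      x≡switch = switch-unique c i a x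
        (swapped⇒switches x≢ci max (swapped-resp i<n d≈ ≈-refl swapped))

  -- U_i respects agreement of chains (the switching element is local)
  U-cong : ∀ {i} → 1 ≤ i → i < n → (c c' : M) → proj₁ c ≈[ n ] proj₁ c' →
           proj₁ (U i c) ≈[ n ] proj₁ (U i c')
  U-cong {i} 1≤i i<n c c' c≈c' = by-cases (ascent? 1≤i i<n c)
    where
      open SetoidReasoning (≈-setoid n)
      by-cases : Ascent n (proj₁ c) i ⊎ ¬ Ascent n (proj₁ c) i → proj₁ (U i c) ≈[ n ] proj₁ (U i c')
      by-cases (inj₂ ¬a) = begin
        proj₁ (U i c)  ≈⟨ U-fixes 1≤i i<n c ¬a ⟩
        proj₁ c        ≈⟨ c≈c' ⟩
        proj₁ c'       ≈⟨ ≈-sym (U-fixes 1≤i i<n c' (λ a' → ¬a (ascent-resp (≈-sym c≈c') a'))) ⟩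
        proj₁ (U i c') ∎
      by-cases (inj₁ a) = begin
        proj₁ (U i c)                          ≈⟨ U-replaces c a ⟩
        replace (proj₁ c) i (switch c i a)     ≡⟨ cong (replace (proj₁ c) i) same-switch ⟩
        replace (proj₁ c) i (switch c' i a')   ≈⟨ replace-cong i _ c≈c' ⟩
        replace (proj₁ c') i (switch c' i a')  ≈⟨ ≈-sym (U-replaces c' a') ⟩
        proj₁ (U i c') ∎
        where
          a' : Ascent n (proj₁ c') i
          a' = ascent-resp c≈c' a
          same-switch : switch c i a ≡ switch c' i a'
          same-switch = switch-local c c' i a a' (≈-weaken i<n c≈c')

  U-local : ∀ {i} → 1 ≤ i → i < n → ∀ c {j} → j ≤ n → j ≢ i → proj₁ (U i c) j ≡ proj₁ c j
  U-local 1≤i i<n c j≤n j≢i with ascent? 1≤i i<n c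
  ... | inj₁ a  = trans (U-replaces c a _ j≤n) (replace-off (proj₁ c) _ _ j≢i)
  ... | inj₂ ¬a = U-fixes 1≤i i<n c ¬a _ j≤n

  U-descent : ∀ {i} → 1 ≤ i → i < n → (c : M) → ¬ Ascent n (proj₁ (U i c)) i
  U-descent 1≤i i<n c with ascent? 1≤i i<n c
  ... | inj₁ a  = swapped-descent (U-swaps c a) a
  ... | inj₂ ¬a = λ b → ¬a (ascent-resp (U-fixes 1≤i i<n c ¬a) b)

  U-idempotent : ∀ {i} → 1 ≤ i → i < n → ∀ c → proj₁ (U i (U i c)) ≈[ n ] proj₁ (U i c)
  U-idempotent {i} 1≤i i<n c = U-fixes 1≤i i<n (U i c) (U-descent 1≤i i<n c)

  U-keeps-ascent : ∀ {i j} → 1 ≤ j → j < n → i < n → Untouched j (pred i) → Untouched j i → ∀ c →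
                   (Ascent n (proj₁ c) i → Ascent n (proj₁ (U j c)) i)
                   × (Ascent n (proj₁ (U j c)) i → Ascent n (proj₁ c) i)
  U-keeps-ascent {i} {j} 1≤j j<n i<n u-lower u-upper c =
    ascent-transfer c (U j c) (sym keeps-lower) (sym keeps-upper) ,
    ascent-transfer (U j c) c keeps-lower keeps-upper
    where
      keeps-lower : lab (U j c) (pred i) ≡ lab c (pred i)
      keeps-lower = U-keeps 1≤j j<n c _ (pred-< i<n) u-lower
      keeps-upper : lab (U j c) i ≡ lab c i
      keeps-upper = U-keeps 1≤j j<n c _ i<n u-upper

  -- When both maps act, U_j (U_i c)
  -- changes U_j c only at rank i, by the switching element of c, and swaps
  -- the right labels; recognition identifies it with U_i (U_j c).
  U-comm-far : ∀ {i j} → 1 ≤ i → i < n → 1 ≤ j → j < n → suc j < i →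
               ∀ c → proj₁ (U i (U j c)) ≈[ n ] proj₁ (U j (U i c))
  U-comm-far {i} {j} 1≤i i<n 1≤j j<n j≪i c = by-cases (ascent? 1≤i i<n c) (ascent? 1≤j j<n c)
    where
      open SetoidReasoning (≈-setoid n)
      i-by-j : (Ascent n (proj₁ c) i → Ascent n (proj₁ (U j c)) i)
               × (Ascent n (proj₁ (U j c)) i → Ascent n (proj₁ c) i)
      i-by-j = U-keeps-ascent 1≤j j<n i<n (far-high j≪i ≤-refl) (far-high j≪i pred[n]≤n) c
      j-by-i : (Ascent n (proj₁ c) j → Ascent n (proj₁ (U i c)) j)
               × (Ascent n (proj₁ (U i c)) j → Ascent n (proj₁ c) j)
      j-by-i = U-keeps-ascent 1≤i i<n j<n (far-low j≪i pred[n]≤n) (far-low j≪i ≤-refl) c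
      i≢j : i ≢ j
      i≢j i≡j = far-prefix j≪i (n≤1+n j) (sym i≡j)

      both-act : Ascent n (proj₁ c) i → Ascent n (proj₁ c) j →
                 proj₁ (U i (U j c)) ≈[ n ] proj₁ (U j (U i c))
      both-act ai aj = U-recognise (U j c) (proj₁ i-by-j ai) (U j (U i c)) x≢ moves-i swaps
        where
          aj' : Ascent n (proj₁ (U i c)) j
          aj' = proj₁ j-by-i aj
          x≢ : switch c i ai ≢ proj₁ (U j c) i
          x≢ x≡ = proj₁ (switch-spec c i ai) (trans x≡ (U-local 1≤j j<n c (<⇒≤ i<n) i≢j))
          -- U_i c and c agree up to rank j+1, so their switching elements at j agree
          same-switch : switch (U i c) j aj' ≡ switch c j aj
          same-switch = switch-local (U i c) c j aj' aj
            (λ k k≤sj → U-local 1≤i i<n c (≤-trans k≤sj j<n) (far-prefix j≪i k≤sj))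
          moves-i : proj₁ (U j (U i c)) ≈[ n ] replace (proj₁ (U j c)) i (switch c i ai)
          moves-i = begin
            proj₁ (U j (U i c))
              ≈⟨ U-replaces (U i c) aj' ⟩
            replace (proj₁ (U i c)) j (switch (U i c) j aj')
              ≡⟨ cong (replace (proj₁ (U i c)) j) same-switch ⟩
            replace (proj₁ (U i c)) j (switch c j aj)
              ≈⟨ replace-cong j _ (U-replaces c ai) ⟩
            replace (replace (proj₁ c) i (switch c i ai)) j (switch c j aj)
              ≈⟨ replace-comm (proj₁ c) _ _ i≢j ⟩
            replace (replace (proj₁ c) j (switch c j aj)) i (switch c i ai)
              ≈⟨ replace-cong i _ (≈-sym (U-replaces c aj)) ⟩
            replace (proj₁ (U j c)) i (switch c i ai) ∎
          swaps : Swapped (U j (U i c)) (U j c) i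
          swaps = swapped-far j≪i i<n j<n (U-swaps c ai) (U-swaps (U i c) aj') (U-swaps c aj)

      by-cases : Ascent n (proj₁ c) i ⊎ ¬ Ascent n (proj₁ c) i →
                 Ascent n (proj₁ c) j ⊎ ¬ Ascent n (proj₁ c) j →
                 proj₁ (U i (U j c)) ≈[ n ] proj₁ (U j (U i c))
      by-cases (inj₁ ai) (inj₁ aj) = both-act ai aj
      by-cases (inj₂ ¬ai) _ = begin
        proj₁ (U i (U j c)) ≈⟨ U-fixes 1≤i i<n (U j c) (λ b → ¬ai (proj₂ i-by-j b)) ⟩
        proj₁ (U j c)       ≈⟨ U-cong 1≤j j<n c (U i c) (≈-sym (U-fixes 1≤i i<n c ¬ai)) ⟩
        proj₁ (U j (U i c)) ∎
      by-cases (inj₁ _) (inj₂ ¬aj) = begin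
        proj₁ (U i (U j c)) ≈⟨ U-cong 1≤i i<n (U j c) c (U-fixes 1≤j j<n c ¬aj) ⟩
        proj₁ (U i c)       ≈⟨ ≈-sym (U-fixes 1≤j j<n (U i c) (λ b → ¬aj (proj₂ j-by-i b))) ⟩
        proj₁ (U j (U i c)) ∎

  U-comm : ∀ {i j} → 1 ≤ i → i < n → 1 ≤ j → j < n → (suc i < j ⊎ suc j < i) →
           ∀ c → proj₁ (U i (U j c)) ≈[ n ] proj₁ (U j (U i c))
  U-comm 1≤i i<n 1≤j j<n (inj₁ i≪j) c = ≈-sym (U-comm-far 1≤j j<n 1≤i i<n i≪j c)
  U-comm 1≤i i<n 1≤j j<n (inj₂ j≪i) c = U-comm-far 1≤i i<n 1≤j j<n j≪i c

  U-fixes-both : ∀ {i j} → 1 ≤ i → i < n → 1 ≤ j → j < n → (c : M) →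
                 ¬ Ascent n (proj₁ c) i → ¬ Ascent n (proj₁ c) j → proj₁ (U j (U i c)) ≈[ n ] proj₁ c
  U-fixes-both {i} 1≤i i<n 1≤j j<n c ¬ai ¬aj =
    ≈-trans (U-fixes 1≤j j<n (U i c) (λ b → ¬aj (ascent-resp Uic≈c b))) Uic≈c
    where
      Uic≈c : proj₁ (U i c) ≈[ n ] proj₁ c
      Uic≈c = U-fixes 1≤i i<n c ¬ai

  -- If c does not ascend at rank i, then U_i U_{i+1} c does not ascend at
  -- rank i+1: the labels of edges i, i+1 of that chain are either those of
  -- edges i-1, i of c, or those of edges i+1, i of U_{i+1} c.
  no-ascent-up : ∀ {i} → 1 ≤ i → suc i < n → (c : M) → ¬ Ascent n (proj₁ c) i →
                 ¬ Ascent n (proj₁ (U i (U (suc i) c))) (suc i)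
  no-ascent-up {i} 1≤i si<n c ¬a₁ b = by-cases (ascent? (s≤s z≤n) si<n c) (ascent? 1≤i i<n e₁)
    where
      i<n : i < n
      i<n = <⇒≤ si<n
      e₁ : M
      e₁ = U (suc i) c
      e₂ : M
      e₂ = U i e₁
      by-cases : Ascent n (proj₁ c) (suc i) ⊎ ¬ Ascent n (proj₁ c) (suc i) →
                 Ascent n (proj₁ e₁) i ⊎ ¬ Ascent n (proj₁ e₁) i → ⊥
      by-cases (inj₂ ¬a₂) _ = ¬a₂ (ascent-resp (U-fixes-both (s≤s z≤n) si<n 1≤i i<n c ¬a₂ ¬a₁) b)
      by-cases (inj₁ a₂) (inj₂ ¬a₃) =
        U-descent (s≤s z≤n) si<n c (ascent-resp (U-fixes 1≤i i<n e₁ ¬a₃) b)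
      by-cases (inj₁ a₂) (inj₁ a₃) =
        ¬a₁ (rise⇒ascent c 1≤i i<n (<L-resp lower-edge upper-edge (ascent⇒rise e₂ b)))
        where
          open Swapped
          lower-edge : lab e₂ i ≡ lab c (pred i)
          lower-edge = trans (upper (U-swaps e₁ a₃))
                             (rest (U-swaps c a₂) _ (pred-< i<n) (proj₁ (adjacent-untouched 1≤i)))
          upper-edge : lab e₂ (suc i) ≡ lab c i
          upper-edge = trans (rest (U-swaps e₁ a₃) _ si<n (proj₂ (adjacent-untouched 1≤i)))
                             (upper (U-swaps c a₂))

  no-ascent-down : ∀ {i} → 1 ≤ i → suc i < n → (c : M) → ¬ Ascent n (proj₁ c) (suc i) →
                   ¬ Ascent n (proj₁ (U (suc i) (U i c))) i
  no-ascent-down {i} 1≤i si<n c ¬a₂ b = by-cases (ascent? 1≤i i<n c) (ascent? (s≤s z≤n) si<n d₁)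
    where
      i<n : i < n
      i<n = <⇒≤ si<n
      d₁ : M
      d₁ = U i c
      d₂ : M
      d₂ = U (suc i) d₁
      by-cases : Ascent n (proj₁ c) i ⊎ ¬ Ascent n (proj₁ c) i →
                 Ascent n (proj₁ d₁) (suc i) ⊎ ¬ Ascent n (proj₁ d₁) (suc i) → ⊥
      by-cases (inj₂ ¬a₁) _ = ¬a₁ (ascent-resp (U-fixes-both 1≤i i<n (s≤s z≤n) si<n c ¬a₁ ¬a₂) b)
      by-cases (inj₁ a₁) (inj₂ ¬a₃) =
        U-descent 1≤i i<n c (ascent-resp (U-fixes (s≤s z≤n) si<n d₁ ¬a₃) b)
      by-cases (inj₁ a₁) (inj₁ a₃) =
        ¬a₂ (rise⇒ascent c (s≤s z≤n) si<n (<L-resp lower-edge upper-edge (ascent⇒rise d₂ b)))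
        where
          open Swapped
          lower-edge : lab d₂ (pred i) ≡ lab c i
          lower-edge = trans (rest (U-swaps d₁ a₃) _ (pred-< i<n) (proj₁ (adjacent-untouched 1≤i)))
                             (lower (U-swaps c a₁))
          upper-edge : lab d₂ i ≡ lab c (suc i)
          upper-edge = trans (lower (U-swaps d₁ a₃))
                             (rest (U-swaps c a₁) _ si<n (proj₂ (adjacent-untouched 1≤i)))

  U-braid : WithSwitching.BraidRelation S → ∀ {i} → 1 ≤ i → suc i < n → ∀ c →
            proj₁ (U i (U (suc i) (U i c))) ≈[ n ] proj₁ (U (suc i) (U i (U (suc i) c)))
  U-braid braid {i} 1≤i si<n c = by-cases (ascent? 1≤i i<n c) (ascent? 1≤si si<n c)
    where
      open SetoidReasoning (≈-setoid n)
      i<n : i < n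
      i<n = <⇒≤ si<n
      1≤si : 1 ≤ suc i
      1≤si = s≤s z≤n
      by-cases : Ascent n (proj₁ c) i ⊎ ¬ Ascent n (proj₁ c) i →
                 Ascent n (proj₁ c) (suc i) ⊎ ¬ Ascent n (proj₁ c) (suc i) →
                 proj₁ (U i (U (suc i) (U i c))) ≈[ n ] proj₁ (U (suc i) (U i (U (suc i) c)))
      by-cases (inj₁ a₁) (inj₁ a₂) =
        braid n (proj₁ c) i (proj₁ (proj₂ c)) a₁ a₂ _ _ _ _ _ _
          (isU i 1≤i i<n c) (isU (suc i) 1≤si si<n (U i c)) (isU i 1≤i i<n (U (suc i) (U i c)))
          (isU (suc i) 1≤si si<n c) (isU i 1≤i i<n (U (suc i) c)) (isU (suc i) 1≤si si<n (U i (U (suc i) c)))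
      by-cases (inj₂ ¬a₁) _ = begin
        proj₁ (U i (U (suc i) (U i c)))
          ≈⟨ U-cong 1≤i i<n _ _ (U-cong 1≤si si<n _ _ (U-fixes 1≤i i<n c ¬a₁)) ⟩
        proj₁ (U i (U (suc i) c))
          ≈⟨ ≈-sym (U-fixes 1≤si si<n _ (no-ascent-up 1≤i si<n c ¬a₁)) ⟩
        proj₁ (U (suc i) (U i (U (suc i) c))) ∎
      by-cases (inj₁ _) (inj₂ ¬a₂) = begin
        proj₁ (U i (U (suc i) (U i c)))
          ≈⟨ U-fixes 1≤i i<n _ (no-ascent-down 1≤i si<n c ¬a₂) ⟩
        proj₁ (U (suc i) (U i c))
          ≈⟨ U-cong 1≤si si<n _ _ (U-cong 1≤i i<n _ _ (≈-sym (U-fixes 1≤si si<n c ¬a₂))) ⟩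
        proj₁ (U (suc i) (U i (U (suc i) c))) ∎

proposition6p1 :
    (P : FinPoset) (bot : FinPoset.Carrier P) → FinPoset.IsMinimum P bot →
    (n : ℕ) → Chains.AllMaxChainsHaveLength P bot n →
    (Λ : LabelPoset) (lab : Chains.MaxChain P bot n → ℕ → LabelPoset.Label Λ) →
    (G : Labelled.IsGeneralizedCW P bot n Λ lab) →
    (U : ℕ → Chains.MaxChain P bot n → Chains.MaxChain P bot n) →
    Labelled.AreUMaps P bot n Λ lab G U →
    let open Chains P bot in
      (∀ i → 1 ≤ i → i < n → ∀ c j → j ≤ n → j ≢ i → proj₁ (U i c) j ≡ proj₁ c j)
    × (∀ i → 1 ≤ i → i < n → ∀ c → proj₁ (U i (U i c)) ≈[ n ] proj₁ (U i c))
    × (∀ i j → 1 ≤ i → i < n → 1 ≤ j → j < n → (suc i < j ⊎ suc j < i) →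
         ∀ c → proj₁ (U i (U j c)) ≈[ n ] proj₁ (U j (U i c)))
    × (∀ i → 1 ≤ i → suc i < n →
         ∀ c → proj₁ (U i (U (suc i) (U i c))) ≈[ n ] proj₁ (U (suc i) (U i (U (suc i) c))))
proposition6p1 P bot _ n _ Λ lab G U isU =
    (λ i 1≤i i<n c j j≤n j≢i → U-local 1≤i i<n c j≤n j≢i)
  , (λ i 1≤i i<n → U-idempotent 1≤i i<n)
  , (λ i j 1≤i i<n 1≤j j<n → U-comm 1≤i i<n 1≤j j<n)
  , (λ i 1≤i si<n → U-braid braid 1≤i si<n)
  where
    open Labelled.IsGeneralizedCW G
    open UMaps P bot n Λ lab isC rankTwo U isU
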